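{- Let $T$ be a string of length $n$ and let $1 \le i < j \le n$. Let $p \in \{i, \ldots, j\}$ be the position such that $T[p..n]$ is the lexicographically minimal string among $T[i..n], T[i+1..n], \ldots, T[j..n]$. Then the lexicographically minimal non-empty suffix of $T[i..j]$ is either equal to $T[p..j]$, or equal to the lexicographically minimal non-empty suffix of $S_j^{\alpha(i,j)}$.
   Context: $T[a..b]$ denotes the substring of $T$ from position $a$ to $b$ inclusive; $\prec$ is the standard lexicographic order ($X \prec Y$ if $X$ is a proper prefix of $Y$ or at the first differing position $X$ has the smaller letter). Canonical substrings: for each position $j$, $S_j^1 = T[j..j]$, and for $\ell \ge 2$, with $m = \lfloor \ell/2 \rfloor - 1$, $S_j^\ell$ is the substring of $T$ ending at position $j$ of length $|S_j^\ell| = 2\cdot 2^m + (j \bmod 2^m)$ if $\ell$ is even and $|S_j^\ell| = 3 \cdot 2^m + (j \bmod 2^m)$ if $\ell$ is odd (i.e. $S_j^\ell = T[j-|S_j^\ell|+1..j]$, defined whenever this length is at most $j$). For $1 \le i < j \le n$, $\alpha(i,j)$ is the largest integer $\ell$ such that $S_j^\ell$ is a proper suffix of $T[i..j]$. -}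

module Defs where

open import Level using (Level)
open import Data.Nat using (ℕ; zero; suc; _+_; _*_; _∸_; _^_; _≤_; _<_; _/_; _%_)
open import Data.Nat.Properties using (m^n≢0)
open import Data.List using (List; []; _∷_; _++_; take; drop; length)
open import Data.Product using (Σ; _×_; ∃-syntax)
open import Relation.Binary.Core using (Rel)
open import Relation.Binary.PropositionalEquality using (_≡_; _≢_)
open import Data.List.Relation.Binary.Lex.Core using (Lex-≤)

private variable a ℓ : Level

-- Substring T[a..b] with 1-indexed positions (inclusive).
sub : {A : Set a} → List A → ℕ → ℕ → List A
sub T a b = take (suc b ∸ a) (drop (a ∸ 1) T)

-- Non-strict lexicographic order  X ⪯ Y  (X ≺ Y or X = Y), where ≺ is the
-- standard lexicographic order (proper prefix is smaller).
_⪯[_]_ : {A : Set a} → List A → Rel A ℓ → List A → Set _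
X ⪯[ _<_ ] Y = Lex-≤ _≡_ _<_ X Y

IsSuffix : {A : Set a} → List A → List A → Set a
IsSuffix X W = ∃[ Y ] (Y ++ X ≡ W)

IsProperSuffix : {A : Set a} → List A → List A → Set a
IsProperSuffix X W = ∃[ Y ] (Y ≢ [] × Y ++ X ≡ W)

IsMinSuffix : {A : Set a} → Rel A ℓ → List A → List A → Set _
IsMinSuffix _<_ X W =
  X ≢ [] × IsSuffix X W ×
  (∀ Y → Y ≢ [] → IsSuffix Y W → X ⪯[ _<_ ] Y)

-- Length |S_j^ℓ| of the canonical substring (ℓ ≥ 1; value at ℓ = 0 unused).
-- For ℓ = k + 2 ≥ 2 : m = ⌊ℓ/2⌋ - 1 = ⌊k/2⌋ and ℓ is even iff k is even.
canLen : ℕ → ℕ → ℕ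
canLen j zero = 0
canLen j (suc zero) = 1
canLen j (suc (suc k)) with k % 2
... | zero  = 2 * 2 ^ (k / 2) + (j % 2 ^ (k / 2)) {{m^n≢0 2 (k / 2)}}
... | suc _ = 3 * 2 ^ (k / 2) + (j % 2 ^ (k / 2)) {{m^n≢0 2 (k / 2)}}

CanDefined : ℕ → ℕ → Set
CanDefined j ℓ = 1 ≤ ℓ × canLen j ℓ ≤ j

canSub : {A : Set a} → List A → ℕ → ℕ → List A
canSub T j ℓ = sub T (suc j ∸ canLen j ℓ) j

IsAlpha : {A : Set a} → List A → ℕ → ℕ → ℕ → Set a
IsAlpha T i j ℓ =
  CanDefined j ℓ × IsProperSuffix (canSub T j ℓ) (sub T i j) ×
  (∀ ℓ′ → CanDefined j ℓ′ → IsProperSuffix (canSub T j ℓ′) (sub T i j) → ℓ′ ≤ ℓ)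

module Submission where

-- Let X be the minimal suffix of W = T[i..j], P = T[p..j] and R = T[j+1..n].
-- If |X| ≤ |S_j^α|, then X is a suffix of S_j^α, which is a suffix of W, so X
-- is minimal there as well. Otherwise maximality of α gives
-- |W| ≤ |S_j^(α+1)| ≤ 2|S_j^α| < 2|X|. Minimality of X gives X ⪯ P and
-- minimality of T[p..n] gives P R ⪯ X R, so P = X U. If U were non-empty,
-- then, X covering more than half of W, U would be a suffix of X, i.e.
-- X = X′ U for a non-empty suffix X′ of W; but X′ ≺ X′ U = X contradicts the
-- minimality of X. Hence X = P.

open import Defs
open import Level using (Level)
open import Data.Nat using (ℕ; zero; suc; _+_; _*_; _∸_; _^_; _≤_; _<_; _%_; _⊓_; z≤n; s≤s)
open import Data.Nat.Properties
open import Data.Nat.DivMod using (m*n%n≡0; [m+kn]%n≡m%n; m*n/n≡m; +-distrib-/-∣ʳ; m%n<n; n%1≡0)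
open import Data.Nat.Divisibility using (divides)
open import Data.Nat.Tactic.RingSolver using (solve-∀)
open import Data.Product using (_×_; _,_; proj₁; proj₂; ∃-syntax)
open import Data.Sum using (_⊎_; inj₁; inj₂)
open import Data.List using (List; []; _∷_; _++_; take; drop; length)
open import Data.List.Relation.Binary.Lex.Core using (base; halt; this; next)
open import Data.List.Properties
  using (∷-injectiveʳ; ++-assoc; ++-cancelʳ; length-++; length-++-≤ˡ; length-++-≤ʳ;
         length-take; length-drop; take-all; drop-drop; take++drop≡id)
open import Data.Empty using (⊥-elim)
open import Relation.Nullary using (¬_)
open import Relation.Binary.Core using (Rel)
open import Relation.Binary.Structures using (IsStrictPartialOrder; IsStrictTotalOrder)
open import Relation.Binary.PropositionalEquality

_%2^_ : ℕ → ℕ → ℕ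
j %2^ t = (j % 2 ^ t) {{m^n≢0 2 t}}

canLen-even : ∀ j t → canLen j (2 + t * 2) ≡ 2 * 2 ^ t + j %2^ t
canLen-even j t rewrite m*n%n≡0 t 2 ⦃ _ ⦄ =
  cong (λ m → 2 * 2 ^ m + j %2^ m) (m*n/n≡m t 2)

canLen-odd : ∀ j t → canLen j (3 + t * 2) ≡ 3 * 2 ^ t + j %2^ t
canLen-odd j t rewrite [m+kn]%n≡m%n 1 t 2 ⦃ _ ⦄ =
  cong (λ m → 3 * 2 ^ m + j %2^ m)
       (trans (+-distrib-/-∣ʳ 1 {t * 2} {2} (divides t refl)) (m*n/n≡m t 2))

even-or-odd : ∀ k → ∃[ t ] (k ≡ t * 2 ⊎ k ≡ 1 + t * 2)
even-or-odd zero = 0 , inj₁ refl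
even-or-odd (suc k) with even-or-odd k
... | t , inj₁ refl = t , inj₂ refl
... | t , inj₂ refl = suc t , inj₁ refl

canLen-suc≤2*canLen : ∀ j ℓ → 1 ≤ ℓ → canLen j (suc ℓ) ≤ 2 * canLen j ℓ
canLen-suc≤2*canLen j 1 _ rewrite n%1≡0 j = ≤-refl
canLen-suc≤2*canLen j (suc (suc k)) _ with even-or-odd k
... | t , inj₁ refl rewrite canLen-odd j t | canLen-even j t =
  ≤-trans (m≤m+n (3 * a + r) (a + r)) (≤-reflexive (identity a r))
  where
  a = 2 ^ t
  r = j %2^ t
  identity : ∀ a r → 3 * a + r + (a + r) ≡ 2 * (2 * a + r)
  identity = solve-∀
... | t , inj₂ refl rewrite canLen-even j (suc t) | canLen-odd j t =
  ≤-trans (+-monoʳ-≤ (2 * (2 * a)) (<⇒≤ (m%n<n j (2 * a) {{m^n≢0 2 (suc t)}})))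
          (≤-trans (m≤m+n (2 * (2 * a) + 2 * a) (2 * r)) (≤-reflexive (identity a r)))
  where
  a = 2 ^ t
  r = j %2^ t
  identity : ∀ a r → 2 * (2 * a) + 2 * a + 2 * r ≡ 2 * (3 * a + r)
  identity = solve-∀

module _ {u} {A : Set u} where

  ++≡++⇒drop-++ : ∀ (B C : List A) {X Y} → B ++ X ≡ C ++ Y → length B ≤ length C →
                  X ≡ drop (length B) C ++ Y
  ++≡++⇒drop-++ []      C       eq _        = eq
  ++≡++⇒drop-++ (_ ∷ B) (_ ∷ C) eq (s≤s le) = ++≡++⇒drop-++ B C (∷-injectiveʳ eq) le

  drop-length-++ : ∀ (B : List A) {Y} → drop (length B) (B ++ Y) ≡ Y
  drop-length-++ []      = refl
  drop-length-++ (_ ∷ B) = drop-length-++ B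

  0<length : ∀ {xs : List A} → xs ≢ [] → 0 < length xs
  0<length {[]}    []≢[] = ⊥-elim ([]≢[] refl)
  0<length {_ ∷ _} _     = s≤s z≤n

  IsSuffix-trans : ∀ {X Y Z : List A} → IsSuffix X Y → IsSuffix Y Z → IsSuffix X Z
  IsSuffix-trans {X} (B , refl) (C , refl) = C ++ B , ++-assoc C B X

  IsProperSuffix⇒IsSuffix : ∀ {X W : List A} → IsProperSuffix X W → IsSuffix X W
  IsProperSuffix⇒IsSuffix (B , _ , B++X≡W) = B , B++X≡W

  IsSuffix-length : ∀ {X W : List A} → IsSuffix X W → length X ≤ length W
  IsSuffix-length (B , refl) = length-++-≤ʳ _ {B}

  IsSuffix-longer : ∀ {X Y W : List A} → IsSuffix X W → IsSuffix Y W → length X ≤ length Y →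
                    IsSuffix X Y
  IsSuffix-longer {X} {Y} (B , B++X≡W) (C , C++Y≡W) |X|≤|Y| =
    drop (length C) B , sym (++≡++⇒drop-++ C B (trans C++Y≡W (sym B++X≡W)) |C|≤|B|)
    where
    |C|≤|B| : length C ≤ length B
    |C|≤|B| = +-cancelʳ-≤ (length Y) (length C) (length B) (begin
      length C + length Y  ≡⟨ length-++ C ⟨
      length (C ++ Y)      ≡⟨ cong length (trans C++Y≡W (sym B++X≡W)) ⟩
      length (B ++ X)      ≡⟨ length-++ B ⟩
      length B + length X  ≤⟨ +-monoʳ-≤ (length B) |X|≤|Y| ⟩
      length B + length Y  ∎)
      where open ≤-Reasoning

  IsMinSuffix-suffix : ∀ {ℓ} {_≺_ : Rel A ℓ} {X W S : List A} → IsMinSuffix _≺_ X W →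
                       IsSuffix S W → length X ≤ length S → IsMinSuffix _≺_ X S
  IsMinSuffix-suffix (X≢[] , X-sfx , minimal) S-sfx |X|≤|S| =
    X≢[] , IsSuffix-longer X-sfx S-sfx |X|≤|S| ,
    λ Y Y≢[] Y-sfx → minimal Y Y≢[] (IsSuffix-trans Y-sfx S-sfx)

module _ {u ℓ} {A : Set u} {_≺_ : Rel A ℓ} (≺-spo : IsStrictPartialOrder _≡_ _≺_) where
  open IsStrictPartialOrder ≺-spo using (irrefl; asym)

  ⪯∧++⪰++⇒prefix : ∀ {X P} R → X ⪯[ _≺_ ] P → (P ++ R) ⪯[ _≺_ ] (X ++ R) →
                   X ≡ P ⊎ ∃[ U ] (U ≢ [] × P ≡ X ++ U)
  ⪯∧++⪰++⇒prefix R (base _) _ = inj₁ refl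
  ⪯∧++⪰++⇒prefix R (halt {y} {ys}) _ = inj₂ (y ∷ ys , (λ ()) , refl)
  ⪯∧++⪰++⇒prefix R (this x≺y) (this y≺x) = ⊥-elim (asym x≺y y≺x)
  ⪯∧++⪰++⇒prefix R (this x≺x) (next refl _) = ⊥-elim (irrefl refl x≺x)
  ⪯∧++⪰++⇒prefix R (next refl _) (this x≺x) = ⊥-elim (irrefl refl x≺x)
  ⪯∧++⪰++⇒prefix R (next {x} refl X⪯P) (next _ P⪯X)
    with ⪯∧++⪰++⇒prefix R X⪯P P⪯X
  ... | inj₁ X≡P = inj₁ (cong (x ∷_) X≡P)
  ... | inj₂ (U , U≢[] , P≡XU) = inj₂ (U , U≢[] , cong (x ∷_) P≡XU)

  xs++ys⋠xs : ∀ xs {ys} → ys ≢ [] → ¬ (xs ++ ys) ⪯[ _≺_ ] xs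
  xs++ys⋠xs []       {[]} ys≢[] _ = ys≢[] refl
  xs++ys⋠xs []       {_ ∷ _} _ ()
  xs++ys⋠xs (x ∷ xs) _ (this x≺x) = irrefl refl x≺x
  xs++ys⋠xs (x ∷ xs) ys≢[] (next _ lt) = xs++ys⋠xs xs ys≢[] lt

  IsMinSuffix⇒≡ : ∀ {X W P} R → IsMinSuffix _≺_ X W → IsSuffix P W → P ≢ [] →
                  (P ++ R) ⪯[ _≺_ ] (X ++ R) → length W < 2 * length X → X ≡ P
  IsMinSuffix⇒≡ {X} {W} R (X≢[] , X-sfx , minimal) P-sfx P≢[] PR⪯XR |W|<2|X|
    with ⪯∧++⪰++⇒prefix R (minimal _ P≢[] P-sfx) PR⪯XR
  ... | inj₁ X≡P = X≡P
  ... | inj₂ (U , U≢[] , refl) =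
    ⊥-elim (xs++ys⋠xs X′ U≢[] (subst (_⪯[ _≺_ ] X′) X≡X′++U (minimal X′ X′≢[] X′-sfx)))
    where
    X-sfx-X++U : IsSuffix X (X ++ U)
    X-sfx-X++U = IsSuffix-longer X-sfx P-sfx (length-++-≤ˡ X)
    V = proj₁ X-sfx-X++U
    V++X≡X++U : V ++ X ≡ X ++ U
    V++X≡X++U = proj₂ X-sfx-X++U
    |V|<|X| : length V < length X
    |V|<|X| = +-cancelʳ-< (length X) (length V) (length X) (begin-strict
      length V + length X  ≡⟨ length-++ V ⟨
      length (V ++ X)      ≡⟨ cong length V++X≡X++U ⟩
      length (X ++ U)      ≤⟨ IsSuffix-length P-sfx ⟩
      length W             <⟨ |W|<2|X| ⟩
      2 * length X         ≡⟨ cong (length X +_) (+-identityʳ (length X)) ⟩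
      length X + length X  ∎)
      where open ≤-Reasoning
    X′ = drop (length V) X
    X≡X′++U : X ≡ X′ ++ U
    X≡X′++U = ++≡++⇒drop-++ V X V++X≡X++U (<⇒≤ |V|<|X|)
    X′≢[] : X′ ≢ []
    X′≢[] X′≡[] = <-irrefl refl
      (subst (0 <_) (trans (sym (length-drop (length V) X)) (cong length X′≡[])) (m<n⇒0<n∸m |V|<|X|))
    X′-sfx : IsSuffix X′ W
    X′-sfx = IsSuffix-trans (take (length V) X , take++drop≡id (length V) X) X-sfx

-- Positions are 1-indexed: sub T (suc a) j = take (j ∸ a) (drop a T) is T[a+1..j].
module _ {u} {A : Set u} (T : List A) where

  sub-++-drop : ∀ {a j} → a ≤ j → sub T (suc a) j ++ drop j T ≡ drop a T
  sub-++-drop {a} {j} a≤j = begin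
    take (j ∸ a) T′ ++ drop j T              ≡⟨ cong (λ k → take (j ∸ a) T′ ++ drop k T) (m+[n∸m]≡n a≤j) ⟨
    take (j ∸ a) T′ ++ drop (a + (j ∸ a)) T  ≡⟨ cong (take (j ∸ a) T′ ++_) (drop-drop a (j ∸ a) T) ⟨
    take (j ∸ a) T′ ++ drop (j ∸ a) T′       ≡⟨ take++drop≡id (j ∸ a) T′ ⟩
    T′                                       ∎
    where
    T′ = drop a T
    open ≡-Reasoning

  sub-to-end : ∀ a → sub T (suc a) (length T) ≡ drop a T
  sub-to-end a = take-all (length T ∸ a) (drop a T) (≤-reflexive (length-drop a T))

  length-sub : ∀ a {j} → j ≤ length T → length (sub T (suc a) j) ≡ j ∸ a
  length-sub a {j} j≤n = begin
    length (take (j ∸ a) (drop a T))  ≡⟨ length-take (j ∸ a) (drop a T) ⟩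
    (j ∸ a) ⊓ length (drop a T)       ≡⟨ m≤n⇒m⊓n≡m j∸a≤|T′| ⟩
    j ∸ a                             ∎
    where
    j∸a≤|T′| : j ∸ a ≤ length (drop a T)
    j∸a≤|T′| = subst (j ∸ a ≤_) (sym (length-drop a T)) (∸-monoˡ-≤ a j≤n)
    open ≡-Reasoning

  sub≢[] : ∀ {a j} → a < j → j ≤ length T → sub T (suc a) j ≢ []
  sub≢[] {a} a<j j≤n sub≡[] = <-irrefl refl
    (subst (0 <_) (trans (sym (length-sub a j≤n)) (cong length sub≡[])) (m<n⇒0<n∸m a<j))

  sub-split : ∀ {a b j} → a ≤ b → b ≤ j → sub T (suc a) j ≡ sub T (suc a) b ++ sub T (suc b) j
  sub-split {a} {b} {j} a≤b b≤j = ++-cancelʳ (drop j T) _ _ (begin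
    sub T (suc a) j ++ drop j T                       ≡⟨ sub-++-drop (≤-trans a≤b b≤j) ⟩
    drop a T                                          ≡⟨ sub-++-drop a≤b ⟨
    sub T (suc a) b ++ drop b T                       ≡⟨ cong (sub T (suc a) b ++_) (sub-++-drop b≤j) ⟨
    sub T (suc a) b ++ (sub T (suc b) j ++ drop j T)  ≡⟨ ++-assoc (sub T (suc a) b) _ _ ⟨
    (sub T (suc a) b ++ sub T (suc b) j) ++ drop j T  ∎)
    where open ≡-Reasoning

  sub-suffix : ∀ {a b j} → a ≤ b → b ≤ j → IsSuffix (sub T (suc b) j) (sub T (suc a) j)
  sub-suffix {a} {b} a≤b b≤j = sub T (suc a) b , sym (sub-split a≤b b≤j)

  sub-properSuffix : ∀ {a b j} → a < b → b ≤ j → j ≤ length T →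
                     IsProperSuffix (sub T (suc b) j) (sub T (suc a) j)
  sub-properSuffix {a} {b} a<b b≤j j≤n =
    sub T (suc a) b , sub≢[] a<b (≤-trans b≤j j≤n) , sym (sub-split (<⇒≤ a<b) b≤j)

  suffix-sub-++-drop : ∀ {a j X} → a ≤ j → j ≤ length T → X ≢ [] → IsSuffix X (sub T (suc a) j) →
                       ∃[ c ] (a ≤ c × c < j × X ++ drop j T ≡ drop c T)
  suffix-sub-++-drop {a} {j} {X} a≤j j≤n X≢[] (B , B++X≡sub) =
    a + length B , m≤m+n a (length B) , a+|B|<j , X++R≡drop
    where
    |B|+|X|≡j∸a : length B + length X ≡ j ∸ a
    |B|+|X|≡j∸a = trans (sym (length-++ B)) (trans (cong length B++X≡sub) (length-sub a j≤n))
    a+|B|<j : a + length B < j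
    a+|B|<j = begin-strict
      a + length B               <⟨ +-monoʳ-< a (m<m+n (length B) (0<length X≢[])) ⟩
      a + (length B + length X)  ≡⟨ cong (a +_) |B|+|X|≡j∸a ⟩
      a + (j ∸ a)                ≡⟨ m+[n∸m]≡n a≤j ⟩
      j                          ∎
      where open ≤-Reasoning
    X++R≡drop : X ++ drop j T ≡ drop (a + length B) T
    X++R≡drop = begin
      X ++ drop j T                                  ≡⟨ drop-length-++ B ⟨
      drop (length B) (B ++ X ++ drop j T)           ≡⟨ cong (drop (length B)) (++-assoc B X _) ⟨
      drop (length B) ((B ++ X) ++ drop j T)         ≡⟨ cong (λ W → drop (length B) (W ++ drop j T)) B++X≡sub ⟩
      drop (length B) (sub T (suc a) j ++ drop j T)  ≡⟨ cong (drop (length B)) (sub-++-drop a≤j) ⟩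
      drop (length B) (drop a T)                     ≡⟨ drop-drop a (length B) T ⟩
      drop (a + length B) T                          ∎
      where open ≡-Reasoning

  canSub≡sub : ∀ {j} ℓ → canLen j ℓ ≤ j → canSub T j ℓ ≡ sub T (suc (j ∸ canLen j ℓ)) j
  canSub≡sub {j} _ L≤j = cong (λ s → sub T s j) (+-∸-assoc 1 L≤j)

  length-canSub : ∀ {j} ℓ → canLen j ℓ ≤ j → j ≤ length T → length (canSub T j ℓ) ≡ canLen j ℓ
  length-canSub {j} ℓ L≤j j≤n = begin
    length (canSub T j ℓ)                    ≡⟨ cong length (canSub≡sub ℓ L≤j) ⟩
    length (sub T (suc (j ∸ canLen j ℓ)) j)  ≡⟨ length-sub (j ∸ canLen j ℓ) j≤n ⟩
    j ∸ (j ∸ canLen j ℓ)                     ≡⟨ m∸[m∸n]≡n L≤j ⟩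
    canLen j ℓ                               ∎
    where open ≡-Reasoning

  IsAlpha⇒≤canLen-suc : ∀ {a j α} → a ≤ j → j ≤ length T → IsAlpha T (suc a) j α →
                        j ∸ a ≤ canLen j (suc α)
  IsAlpha⇒≤canLen-suc {a} {j} {α} a≤j j≤n (_ , _ , maximal) = ≮⇒≥ λ L<j∸a →
    1+n≰n (maximal (suc α) (s≤s z≤n , L≤j L<j∸a) (S-properSuffix L<j∸a))
    where
    L = canLen j (suc α)
    L≤j : L < j ∸ a → L ≤ j
    L≤j L<j∸a = ≤-trans (<⇒≤ L<j∸a) (m∸n≤m j a)
    a<j∸L : L < j ∸ a → a < j ∸ L
    a<j∸L L<j∸a = m+n≤o⇒m≤o∸n (suc a)
      (subst (_≤ j) (cong suc (+-comm L a)) (m≤o∸n⇒m+n≤o (suc L) a≤j L<j∸a))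
    S-properSuffix : L < j ∸ a → IsProperSuffix (canSub T j (suc α)) (sub T (suc a) j)
    S-properSuffix L<j∸a =
      subst (λ S → IsProperSuffix S (sub T (suc a) j)) (sym (canSub≡sub (suc α) (L≤j L<j∸a)))
            (sub-properSuffix (a<j∸L L<j∸a) (m∸n≤m j L) j≤n)

lemma3 : {a ℓ : Level} {A : Set a} (_<ₐ_ : Rel A ℓ) → IsStrictTotalOrder _≡_ _<ₐ_ →
         (T : List A) (i j : ℕ) → 1 ≤ i → i < j → j ≤ length T →
         (p : ℕ) → i ≤ p → p ≤ j →
         (∀ k → i ≤ k → k ≤ j → sub T p (length T) ⪯[ _<ₐ_ ] sub T k (length T)) →
         (α : ℕ) → IsAlpha T i j α →
         (X : List A) → IsMinSuffix _<ₐ_ X (sub T i j) →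
         X ≡ sub T p j ⊎ IsMinSuffix _<ₐ_ X (canSub T j α)
lemma3 _<ₐ_ sto T (suc a) j (s≤s z≤n) _ j≤n (suc b) (s≤s a≤b) b<j p-minimal
       α α-is@((1≤α , Lα≤j) , S-properSuffix , _) X X-min@(X≢[] , X-sfx , _)
  with ≤-<-connex (length X) (canLen j α)
... | inj₁ |X|≤Lα =
  inj₂ (IsMinSuffix-suffix X-min (IsProperSuffix⇒IsSuffix S-properSuffix)
                           (subst (length X ≤_) (sym (length-canSub T α Lα≤j j≤n)) |X|≤Lα))
... | inj₂ Lα<|X| with suffix-sub-++-drop T (≤-trans a≤b (<⇒≤ b<j)) j≤n X≢[] X-sfx
...   | c , a≤c , c<j , X++R≡drop =
  inj₁ (IsMinSuffix⇒≡ (IsStrictTotalOrder.isStrictPartialOrder sto) (drop j T) X-min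
                      (sub-suffix T a≤b (<⇒≤ b<j)) (sub≢[] T b<j j≤n) P++R⪯X++R |W|<2|X|)
  where
  P++R⪯X++R : (sub T (suc b) j ++ drop j T) ⪯[ _<ₐ_ ] (X ++ drop j T)
  P++R⪯X++R = subst₂ _⪯[ _<ₐ_ ]_
    (trans (sub-to-end T b) (sym (sub-++-drop T (<⇒≤ b<j))))
    (trans (sub-to-end T c) (sym X++R≡drop))
    (p-minimal (suc c) (s≤s a≤c) c<j)
  |W|<2|X| : length (sub T (suc a) j) < 2 * length X
  |W|<2|X| = begin-strict
    length (sub T (suc a) j)  ≡⟨ length-sub T a j≤n ⟩
    j ∸ a                     ≤⟨ IsAlpha⇒≤canLen-suc T (≤-trans a≤b (<⇒≤ b<j)) j≤n α-is ⟩
    canLen j (suc α)          ≤⟨ canLen-suc≤2*canLen j α 1≤α ⟩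
    2 * canLen j α            <⟨ *-monoʳ-< 2 Lα<|X| ⟩
    2 * length X              ∎
    where open ≤-Reasoning
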